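{- If $G$ is a minimally $1$-tough series–parallel graph, then $G$ is a cycle.
   Context: All graphs are finite and undirected; parallel edges are allowed. For a graph $H$, $c(H)$ denotes its number of components. A set $S\subseteq V(G)$ is a cutset if $c(G-S)>1$. $G$ is $t$-tough if $|S|\ge t\cdot c(G-S)$ for every cutset $S$; the toughness $\tau(G)$ is the largest such $t$, with $\tau(K_n)=\infty$. $G$ is minimally $t$-tough if $\tau(G)=t$ and $\tau(G-e)<t$ for every edge $e$. A series–parallel graph $G(s,t)$ with terminals $s,t$ is either a single edge $st$, or is obtained from series–parallel graphs $G_1(s_1,t_1),\dots,G_k(s_k,t_k)$, $k\ge 2$, by a series join (identify $t_i$ with $s_{i+1}$ for $1\le i\le k-1$, set $s=s_1$, $t=t_k$) or a parallel join (identify all $s_i$ into $s$ and all $t_i$ into $t$). -}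

module Defs where

open import Data.Nat using (ℕ; zero; suc; _<_; _≤_)
open import Data.Fin using (Fin; zero; suc; inject₁; fromℕ)
open import Data.Fin.Subset using (Subset; _∉_; ∣_∣)
open import Data.List using (List; []; _∷_; _++_; length; lookup; removeAt; map)
open import Data.List.Membership.Propositional using (_∈_)
open import Data.Product using (Σ; ∃; _×_; _,_)
open import Data.Sum using (_⊎_)
open import Data.Integer using (+_)
open import Data.Rational as ℚ using (ℚ; _/_)
open import Function.Bundles using (_↔_; Inverse)
open import Relation.Binary.PropositionalEquality using (_≡_)

-- A finite undirected multigraph on vertex set Fin n; each list entry (u , v)
-- is one (undirected) edge joining u and v. Parallel edges = repeated entries.
record Graph : Set where
  constructor graph
  field
    n : ℕ
    E : List (Fin n × Fin n)
open Graph public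

SameEdge : {m : ℕ} → Fin m × Fin m → Fin m × Fin m → Set
SameEdge (a , b) (c , d) = (a ≡ c × b ≡ d) ⊎ (a ≡ d × b ≡ c)

mapEdge : {m k : ℕ} → (Fin m → Fin k) → Fin m × Fin m → Fin k × Fin k
mapEdge f (a , b) = f a , f b

_≈E_ : {m : ℕ} → List (Fin m × Fin m) → List (Fin m × Fin m) → Set
E₁ ≈E E₂ = Σ (Fin (length E₁) ↔ Fin (length E₂)) λ ψ →
  ∀ i → SameEdge (lookup E₁ i) (lookup E₂ (Inverse.to ψ i))

_≅_ : Graph → Graph → Set
G ≅ H = Σ (Fin (n G) ↔ Fin (n H)) λ φ → map (mapEdge (Inverse.to φ)) (E G) ≈E E H

K₂ : Graph
K₂ = graph 2 ((zero , suc zero) ∷ [])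

data IsSP : (G : Graph) → Fin (n G) → Fin (n G) → Set where
  edge : (G : Graph) (s t : Fin (n G)) (φ : Fin 2 ↔ Fin (n G)) →
         Inverse.to φ zero ≡ s → Inverse.to φ (suc zero) ≡ t →
         map (mapEdge (Inverse.to φ)) (E K₂) ≈E E G →
         IsSP G s t
  -- G is obtained from G₁, G₂ by identifying t₁ with s₂; f₁, f₂ embed them.
  series : (G₁ : Graph) (s₁ t₁ : Fin (n G₁)) (G₂ : Graph) (s₂ t₂ : Fin (n G₂)) →
           IsSP G₁ s₁ t₁ → IsSP G₂ s₂ t₂ →
           (G : Graph) (s t : Fin (n G)) →
           (f₁ : Fin (n G₁) → Fin (n G)) (f₂ : Fin (n G₂) → Fin (n G)) →
           (∀ x y → f₁ x ≡ f₁ y → x ≡ y) → (∀ x y → f₂ x ≡ f₂ y → x ≡ y) →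
           (∀ v → (∃ λ x → f₁ x ≡ v) ⊎ (∃ λ y → f₂ y ≡ v)) →
           (∀ x y → f₁ x ≡ f₂ y → x ≡ t₁ × y ≡ s₂) →
           f₁ t₁ ≡ f₂ s₂ → f₁ s₁ ≡ s → f₂ t₂ ≡ t →
           (map (mapEdge f₁) (E G₁) ++ map (mapEdge f₂) (E G₂)) ≈E E G →
           IsSP G s t
  -- G is obtained from G₁, G₂ by identifying s₁ with s₂ and t₁ with t₂.
  parallel : (G₁ : Graph) (s₁ t₁ : Fin (n G₁)) (G₂ : Graph) (s₂ t₂ : Fin (n G₂)) →
           IsSP G₁ s₁ t₁ → IsSP G₂ s₂ t₂ →
           (G : Graph) (s t : Fin (n G)) →
           (f₁ : Fin (n G₁) → Fin (n G)) (f₂ : Fin (n G₂) → Fin (n G)) →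
           (∀ x y → f₁ x ≡ f₁ y → x ≡ y) → (∀ x y → f₂ x ≡ f₂ y → x ≡ y) →
           (∀ v → (∃ λ x → f₁ x ≡ v) ⊎ (∃ λ y → f₂ y ≡ v)) →
           (∀ x y → f₁ x ≡ f₂ y → (x ≡ s₁ × y ≡ s₂) ⊎ (x ≡ t₁ × y ≡ t₂)) →
           f₁ s₁ ≡ s → f₂ s₂ ≡ s → f₁ t₁ ≡ t → f₂ t₂ ≡ t →
           (map (mapEdge f₁) (E G₁) ++ map (mapEdge f₂) (E G₂)) ≈E E G →
           IsSP G s t

SeriesParallel : Graph → Set
SeriesParallel G = Σ (Fin (n G)) λ s → Σ (Fin (n G)) λ t → IsSP G s t

Adj : (G : Graph) → Fin (n G) → Fin (n G) → Set
Adj G u v = ((u , v) ∈ E G) ⊎ ((v , u) ∈ E G)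

data Reach (G : Graph) (S : Subset (n G)) : Fin (n G) → Fin (n G) → Set where
  here : ∀ {u} → u ∉ S → Reach G S u u
  step : ∀ {u w v} → u ∉ S → Adj G u w → Reach G S w v → Reach G S u v

-- c(G - S) = k : there are k vertices of G - S, pairwise in different
-- components, such that every vertex of G - S lies in one of their components.
NumComponents : (G : Graph) → Subset (n G) → ℕ → Set
NumComponents G S k = Σ (Fin k → Fin (n G)) λ r →
  (∀ i → r i ∉ S) ×
  (∀ i j → Reach G S (r i) (r j) → i ≡ j) ×
  (∀ v → v ∉ S → ∃ λ i → Reach G S v (r i))

Cutset : (G : Graph) → Subset (n G) → ℕ → Set
Cutset G S k = NumComponents G S k × 1 < k

toℚ : ℕ → ℚ
toℚ m = (+ m) / 1

IsTough : Graph → ℚ → Set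
IsTough G t = ∀ (S : Subset (n G)) (k : ℕ) → Cutset G S k → t ℚ.* toℚ k ℚ.≤ toℚ ∣ S ∣

Toughness : Graph → ℚ → Set
Toughness G t = IsTough G t × (∀ t′ → IsTough G t′ → t′ ℚ.≤ t)

deleteEdge : (G : Graph) → Fin (length (E G)) → Graph
deleteEdge G e = graph (n G) (removeAt (E G) e)

MinimallyTough : Graph → ℚ → Set
MinimallyTough G t = Toughness G t ×
  (∀ e → Σ ℚ λ t′ → Toughness (deleteEdge G e) t′ × t′ ℚ.< t)

cycleGraph : ℕ → Graph
cycleGraph zero = graph zero []
cycleGraph (suc k) = graph (suc k)
  (map (λ (i : Fin k) → inject₁ i , suc i) (Data.List.allFin k) ++ ((fromℕ k , zero) ∷ []))

IsCycle : Graph → Set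
IsCycle G = 3 ≤ n G × G ≅ cycleGraph (n G)

-- Write a series–parallel graph G as nested series and parallel joins. A piece H of the
-- decomposition with terminals a, b meets the rest of G only in a and b. If H is a parallel join
-- whose two sides both have inner vertices and some vertex of G lies outside H, deleting a and b
-- leaves at least three components, which 1-toughness forbids; a series join at the top level
-- would give a cut vertex. Induction over the decomposition then yields Hamiltonian a–b paths
-- of the pieces and a Hamiltonian cycle of G. A Hamiltonian cycle is already 1-tough, so by
-- minimality no edge of G can be deleted without destroying it: G is exactly that cycle.

module Submission where

open import Defs
open import Data.Rational using (1ℚ)

open import Data.Bool using (true; false)
open import Data.Empty using (⊥; ⊥-elim)
open import Data.Fin as Fin using (Fin; zero; suc; fromℕ; inject₁; _≟_)
import Data.Fin.Properties as FinP
open import Data.Fin.Permutation using (↔⇒≡)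
open import Data.Fin.Subset as Sub using (Subset; ∣_∣; ⁅_⁆; _∪_) renaming (_∈_ to _∈ₛ_; _∉_ to _∉ₛ_)
import Data.Fin.Subset.Properties as SubP
open import Data.Integer as ℤ using (+_)
import Data.Integer.Properties as ℤP
open import Data.List as List using (List; []; _∷_; _++_; length; map; lookup; tabulate; reverse; removeAt)
import Data.List.Properties as ListP
open import Data.List.Membership.Propositional using (_∈_; find)
import Data.List.Membership.Propositional.Properties as ∈P
open import Data.List.Relation.Unary.All as All using (All; []; _∷_)
open import Data.List.Relation.Unary.AllPairs as AllPairs using (AllPairs; []; _∷_)
import Data.List.Relation.Unary.AllPairs.Properties as AllPairsP
open import Data.List.Relation.Unary.Any as Any using (Any; here; there)
import Data.List.Relation.Unary.Any.Properties as AnyP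
open import Data.List.Relation.Unary.Unique.Propositional using (Unique)
import Data.List.Relation.Unary.Unique.Propositional.Properties as UniqueP
open import Data.List.Relation.Binary.Permutation.Propositional using (↭-sym; ↭⇒↭ₛ)
open import Data.List.Relation.Binary.Permutation.Propositional.Properties using (↭-reverse)
import Data.List.Relation.Binary.Permutation.Setoid.Properties as PermutationₛP
open import Data.Nat as ℕ using (ℕ; zero; suc; _+_; _≤_; _<_; z≤n; s≤s; _≤?_)
import Data.Nat.Coprimality as Coprime
import Data.Nat.Properties as ℕP
open import Data.Product using (∃; ∃₂; _×_; _,_; proj₁; proj₂)
open import Data.Rational as ℚ using (mkℚ)
import Data.Rational.Properties as ℚP
open import Data.Sum as Sum using (_⊎_; inj₁; inj₂; [_,_]; [_,_]′; swap)
import Data.Vec as Vec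
open import Data.Vec.Functional using (Vector) renaming (_∷_ to _∷ᵛ_; [] to []ᵛ)
open import Effect.Monad using (RawMonad)
import Level
open import Function using (_∘_; id; case_of_)
open import Function.Bundles using (_↔_; Inverse; mk↔ₛ′)
open import Relation.Binary.PropositionalEquality
  using (_≡_; _≢_; refl; sym; trans; cong; cong₂; subst; subst₂; setoid)
open import Relation.Nullary using (¬_; Dec; yes; no)
open import Relation.Nullary.Decidable using (decidable-stable; ¬¬-excluded-middle; _×-dec_; _⊎-dec_)
open import Relation.Nullary.Negation using (¬¬-Monad; ¬¬-map)

open RawMonad (¬¬-Monad {a = Level.zero}) using (_>>=_; rawApplicative)

Vertex : Graph → Set
Vertex G = Fin (n G)

toℚ≡mkℚ : ∀ m → toℚ m ≡ mkℚ (+ m) 0 (Coprime.sym (Coprime.1-coprimeTo m))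
toℚ≡mkℚ m = ℚP.normalize-coprime (Coprime.sym (Coprime.1-coprimeTo m))

toℚ-cancel-≤ : ∀ {m k} → toℚ m ℚ.≤ toℚ k → m ≤ k
toℚ-cancel-≤ {m} {k} m≤k rewrite toℚ≡mkℚ m | toℚ≡mkℚ k = ℤP.drop‿+≤+
  (subst₂ ℤ._≤_ (ℤP.*-identityʳ (+ m)) (ℤP.*-identityʳ (+ k)) (ℚP.drop-*≤* m≤k))

toℚ-mono-≤ : ∀ {m k} → m ≤ k → toℚ m ℚ.≤ toℚ k
toℚ-mono-≤ {m} {k} m≤k rewrite toℚ≡mkℚ m | toℚ≡mkℚ k = ℚ.*≤*
  (subst₂ ℤ._≤_ (sym (ℤP.*-identityʳ (+ m))) (sym (ℤP.*-identityʳ (+ k))) (ℤ.+≤+ m≤k))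

1-tough⇒ : ∀ {G} → IsTough G 1ℚ → ∀ S k → Cutset G S k → k ≤ ∣ S ∣
1-tough⇒ tough S k cut = toℚ-cancel-≤ (subst (ℚ._≤ _) (ℚP.*-identityˡ _) (tough S k cut))

1-tough⇐ : ∀ {G} → (∀ S k → Cutset G S k → k ≤ ∣ S ∣) → IsTough G 1ℚ
1-tough⇐ bound S k cut = subst (ℚ._≤ _) (sym (ℚP.*-identityˡ _)) (toℚ-mono-≤ (bound S k cut))

cutsetFree⇒¬toughness1 : ∀ {G} → (∀ S k → ¬ Cutset G S k) → ¬ Toughness G 1ℚ
cutsetFree⇒¬toughness1 noCut (_ , maximal) with maximal (toℚ 2) (λ S k cut → ⊥-elim (noCut S k cut))
... | ℚ.*≤* (ℤ.+≤+ (s≤s ()))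

-- Components of G − S

module _ {G : Graph} {S : Subset (n G)} where

  reach-start : ∀ {u v} → Reach G S u v → u ∉ₛ S
  reach-start (here u∉S) = u∉S
  reach-start (step u∉S _ _) = u∉S

  reach-end : ∀ {u v} → Reach G S u v → v ∉ₛ S
  reach-end (here v∉S) = v∉S
  reach-end (step _ _ p) = reach-end p

  reach-trans : ∀ {u v w} → Reach G S u v → Reach G S v w → Reach G S u w
  reach-trans (here _) q = q
  reach-trans (step u∉S a p) q = step u∉S a (reach-trans p q)

  reach-sym : ∀ {u v} → Reach G S u v → Reach G S v u
  reach-sym (here u∉S) = here u∉S
  reach-sym (step u∉S a p) = reach-trans (reach-sym p) (step (reach-start p) (swap a) (here u∉S))

  reach-closed : (P : Vertex G → Set) → (∀ {u v} → P u → u ∉ₛ S → Adj G u v → v ∉ₛ S → P v) →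
                 ∀ {u v} → Reach G S u v → P u → P v
  reach-closed P closed (here _) Pu = Pu
  reach-closed P closed (step u∉S a p) Pu = reach-closed P closed p (closed Pu u∉S a (reach-start p))

  Separated : (m : ℕ) → Vector (Vertex G) m → Set
  Separated m r = (∀ i → r i ∉ₛ S) × (∀ i j → Reach G S (r i) (r j) → i ≡ j)

  separated-by : ∀ {m} {r : Vector (Vertex G) m} (C : Fin m → Vertex G → Set) →
                 (∀ i {u v} → C i u → u ∉ₛ S → Adj G u v → v ∉ₛ S → C i v) →
                 (∀ i → C i (r i)) → (∀ i j → C i (r j) → i ≡ j) →
                 (∀ i → r i ∉ₛ S) → Separated m r
  separated-by C closed C-r exclusive r∉S =
    r∉S , λ i j p → exclusive i j (reach-closed (C i) (closed i) p (C-r i))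

  separated⇒≤ : ∀ {m} {r : Vector (Vertex G) m} → Separated m r → m ≤ n G
  separated⇒≤ {r = r} (r∉S , r-sep) =
    FinP.injective⇒≤ λ {i} {j} e → r-sep i j (subst (Reach G S (r i)) e (here (r∉S i)))

  -- Classically, a separated family grows until it represents every component; d bounds
  -- the number of further extensions.
  ¬¬components≥ : ∀ d {m} (r : Vector (Vertex G) m) → n G ≤ m + d → Separated m r →
                  ¬ ¬ (∃ λ k → m ≤ k × NumComponents G S k)
  ¬¬components≥ d {m} r bound (r∉S , r-sep) = ¬¬-excluded-middle {A = ∃ Unreached} >>= λ
    { (yes (v , v-unreached)) → extend d bound v v-unreached
    ; (no all-reached) → ¬¬-map (λ covered → m , ℕP.≤-refl , r , r∉S , r-sep , covered)
                                 (FinP.sequence rawApplicative (reached all-reached)) }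
    where
    Unreached : Vertex G → Set
    Unreached v = v ∉ₛ S × ¬ ∃ λ i → Reach G S v (r i)

    reached : ¬ ∃ Unreached → ∀ v → ¬ ¬ (v ∉ₛ S → ∃ λ i → Reach G S v (r i))
    reached all-reached v k = all-reached (v , (λ v∈S → k (λ v∉S → ⊥-elim (v∉S v∈S))) , λ p → k (λ _ → p))

    extended : ∀ v → Unreached v → Separated (suc m) (v ∷ᵛ r)
    extended v (v∉S , unreached) = (λ { zero → v∉S ; (suc i) → r∉S i }) , λ
      { zero zero _ → refl
      ; zero (suc j) p → ⊥-elim (unreached (j , p))
      ; (suc i) zero p → ⊥-elim (unreached (i , reach-sym p))
      ; (suc i) (suc j) p → cong suc (r-sep i j p) }

    extend : ∀ d → n G ≤ m + d → ∀ v → Unreached v → ¬ ¬ (∃ λ k → m ≤ k × NumComponents G S k)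
    extend zero bound v unreached = ⊥-elim (ℕP.<-irrefl refl
      (ℕP.≤-trans (separated⇒≤ (extended v unreached)) (ℕP.≤-trans bound (ℕP.≤-reflexive (ℕP.+-identityʳ m)))))
    extend (suc d) bound v unreached = ¬¬-map (λ (k , m<k , c) → k , ℕP.<⇒≤ m<k , c)
      (¬¬components≥ d (v ∷ᵛ r) (subst (n G ≤_) (ℕP.+-suc m d) bound) (extended v unreached))

1-tough⇒separated≤ : ∀ {G S m} {r : Vector (Vertex G) m} → IsTough G 1ℚ →
                     Separated {G} {S} m r → 1 < m → m ≤ ∣ S ∣
1-tough⇒separated≤ {G} {S} {m} {r} tough sep 1<m = decidable-stable (m ≤? ∣ S ∣)
  (¬¬-map (λ (k , m≤k , c) → ℕP.≤-trans m≤k (1-tough⇒ tough S k (c , ℕP.<-≤-trans 1<m m≤k)))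
          (¬¬components≥ (n G) r (ℕP.m≤n+m (n G) m) sep))

∣p∪q∣≤∣p∣+∣q∣ : ∀ {k} (p q : Subset k) → ∣ p ∪ q ∣ ≤ ∣ p ∣ + ∣ q ∣
∣p∪q∣≤∣p∣+∣q∣ Vec.[] Vec.[] = z≤n
∣p∪q∣≤∣p∣+∣q∣ (true Vec.∷ p) (true Vec.∷ q) =
  s≤s (ℕP.≤-trans (∣p∪q∣≤∣p∣+∣q∣ p q) (ℕP.+-monoʳ-≤ ∣ p ∣ (ℕP.n≤1+n ∣ q ∣)))
∣p∪q∣≤∣p∣+∣q∣ (true Vec.∷ p) (false Vec.∷ q) = s≤s (∣p∪q∣≤∣p∣+∣q∣ p q)
∣p∪q∣≤∣p∣+∣q∣ (false Vec.∷ p) (true Vec.∷ q) =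
  ℕP.≤-trans (s≤s (∣p∪q∣≤∣p∣+∣q∣ p q)) (ℕP.≤-reflexive (sym (ℕP.+-suc ∣ p ∣ ∣ q ∣)))
∣p∪q∣≤∣p∣+∣q∣ (false Vec.∷ p) (false Vec.∷ q) = ∣p∪q∣≤∣p∣+∣q∣ p q

∣⁅x⁆∪⁅y⁆∣≤2 : ∀ {k} (x y : Fin k) → ∣ ⁅ x ⁆ ∪ ⁅ y ⁆ ∣ ≤ 2
∣⁅x⁆∪⁅y⁆∣≤2 x y = ℕP.≤-trans (∣p∪q∣≤∣p∣+∣q∣ ⁅ x ⁆ ⁅ y ⁆)
                             (ℕP.≤-reflexive (cong₂ _+_ (SubP.∣⁅x⁆∣≡1 x) (SubP.∣⁅x⁆∣≡1 y)))

injective⇒≤∣p∣ : ∀ {k m} (p : Subset k) (f : Fin m → Fin k) → (∀ i j → f i ≡ f j → i ≡ j) →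
                 (∀ i → f i ∈ₛ p) → m ≤ ∣ p ∣
injective⇒≤∣p∣ {m = zero} p f f-inj f∈p = z≤n
injective⇒≤∣p∣ {m = suc m} p f f-inj f∈p = ℕP.<-≤-trans
  (s≤s (injective⇒≤∣p∣ (p Sub.- f zero) (f ∘ suc) (λ i j e → FinP.suc-injective (f-inj (suc i) (suc j) e))
         (λ i → SubP.x∈p∧x≢y⇒x∈p-y (f∈p (suc i)) (λ e → 0≢1+n (sym (f-inj (suc i) zero e))))))
  (SubP.x∈p⇒∣p-x∣<∣p∣ (f∈p zero))
  where
  0≢1+n : ∀ {i : Fin m} → zero ≢ suc i
  0≢1+n ()

Terminal : ∀ {k} → Fin k → Fin k → Fin k → Set
Terminal a b x = x ≡ a ⊎ x ≡ b

three-distinct⇒3≤ : ∀ {k} {a b c : Fin k} → a ≢ b → ¬ Terminal a b c → 3 ≤ k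
three-distinct⇒3≤ {a = a} {b} {c} a≢b c∉ab = FinP.injective⇒≤ {f = a ∷ᵛ b ∷ᵛ c ∷ᵛ []ᵛ} injective
  where
  injective : ∀ {i j} → (a ∷ᵛ b ∷ᵛ c ∷ᵛ []ᵛ) i ≡ (a ∷ᵛ b ∷ᵛ c ∷ᵛ []ᵛ) j → i ≡ j
  injective {zero} {zero} _ = refl
  injective {zero} {suc zero} e = ⊥-elim (a≢b e)
  injective {zero} {suc (suc zero)} e = ⊥-elim (c∉ab (inj₁ (sym e)))
  injective {suc zero} {zero} e = ⊥-elim (a≢b (sym e))
  injective {suc zero} {suc zero} _ = refl
  injective {suc zero} {suc (suc zero)} e = ⊥-elim (c∉ab (inj₂ (sym e)))
  injective {suc (suc zero)} {zero} e = ⊥-elim (c∉ab (inj₁ e))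
  injective {suc (suc zero)} {suc zero} e = ⊥-elim (c∉ab (inj₂ e))
  injective {suc (suc zero)} {suc (suc zero)} _ = refl

AdjL : ∀ {k} → List (Fin k × Fin k) → Fin k → Fin k → Set
AdjL Es u v = (u , v) ∈ Es ⊎ (v , u) ∈ Es

module _ {k : ℕ} where

  SameEdge-sym : {p q : Fin k × Fin k} → SameEdge p q → SameEdge q p
  SameEdge-sym (inj₁ (refl , refl)) = inj₁ (refl , refl)
  SameEdge-sym (inj₂ (refl , refl)) = inj₂ (refl , refl)

  SameEdge-trans : {p q r : Fin k × Fin k} → SameEdge p q → SameEdge q r → SameEdge p r
  SameEdge-trans (inj₁ (refl , refl)) s = s
  SameEdge-trans (inj₂ (refl , refl)) (inj₁ (refl , refl)) = inj₂ (refl , refl)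
  SameEdge-trans (inj₂ (refl , refl)) (inj₂ (refl , refl)) = inj₁ (refl , refl)

  SameEdge? : (p q : Fin k × Fin k) → Dec (SameEdge p q)
  SameEdge? (a , b) (c , d) = ((a ≟ c) ×-dec (b ≟ d)) ⊎-dec ((a ≟ d) ×-dec (b ≟ c))

  SameEdge-map : ∀ {m} (f : Fin k → Fin m) {p q} → SameEdge p q → SameEdge (mapEdge f p) (mapEdge f q)
  SameEdge-map f (inj₁ (refl , refl)) = inj₁ (refl , refl)
  SameEdge-map f (inj₂ (refl , refl)) = inj₂ (refl , refl)

  SameEdge-map⁻ : ∀ {m} (f : Fin k → Fin m) → (∀ {x y} → f x ≡ f y → x ≡ y) →
                  ∀ {p q} → SameEdge (mapEdge f p) (mapEdge f q) → SameEdge p q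
  SameEdge-map⁻ f f-inj (inj₁ (e₁ , e₂)) = inj₁ (f-inj e₁ , f-inj e₂)
  SameEdge-map⁻ f f-inj (inj₂ (e₁ , e₂)) = inj₂ (f-inj e₁ , f-inj e₂)

  SameEdge⇒AdjL : ∀ {Es : List (Fin k × Fin k)} {q u v} → q ∈ Es → SameEdge q (u , v) → AdjL Es u v
  SameEdge⇒AdjL q∈Es (inj₁ (refl , refl)) = inj₁ q∈Es
  SameEdge⇒AdjL q∈Es (inj₂ (refl , refl)) = inj₂ q∈Es

  ≈E-sym : {A B : List (Fin k × Fin k)} → A ≈E B → B ≈E A
  ≈E-sym {A} {B} (ψ , same) = ψ⁻¹ , λ j →
    SameEdge-sym (subst (λ i → SameEdge (lookup A (Inverse.from ψ j)) (lookup B i))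
                        (Inverse.strictlyInverseˡ ψ j) (same (Inverse.from ψ j)))
    where ψ⁻¹ = mk↔ₛ′ (Inverse.from ψ) (Inverse.to ψ) (Inverse.strictlyInverseʳ ψ) (Inverse.strictlyInverseˡ ψ)

  ≈E-∈ : {A B : List (Fin k × Fin k)} → A ≈E B → ∀ {q} → q ∈ A → ∃ λ p → p ∈ B × SameEdge q p
  ≈E-∈ {A} {B} (ψ , same) q∈A = lookup B (Inverse.to ψ i) , ∈P.∈-lookup _ ,
    subst (λ q → SameEdge q (lookup B (Inverse.to ψ i))) (sym (AnyP.lookup-index q∈A)) (same i)
    where i = Any.index q∈A

  ≈E-AdjL : {A B : List (Fin k × Fin k)} → A ≈E B → ∀ {u v} → AdjL A u v → AdjL B u v
  ≈E-AdjL A≈B (inj₁ uv∈A) = let p , p∈B , same = ≈E-∈ A≈B uv∈A in SameEdge⇒AdjL p∈B (SameEdge-sym same)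
  ≈E-AdjL A≈B (inj₂ vu∈A) = swap (let p , p∈B , same = ≈E-∈ A≈B vu∈A in SameEdge⇒AdjL p∈B (SameEdge-sym same))

  AdjL-++⁻ : ∀ (A : List (Fin k × Fin k)) {B u v} → AdjL (A ++ B) u v → AdjL A u v ⊎ AdjL B u v
  AdjL-++⁻ A (inj₁ p) = [ inj₁ ∘ inj₁ , inj₂ ∘ inj₁ ] (∈P.∈-++⁻ A p)
  AdjL-++⁻ A (inj₂ p) = [ inj₁ ∘ inj₂ , inj₂ ∘ inj₂ ] (∈P.∈-++⁻ A p)

  AdjL-++⁺ˡ : ∀ {A B : List (Fin k × Fin k)} {u v} → AdjL A u v → AdjL (A ++ B) u v
  AdjL-++⁺ˡ (inj₁ p) = inj₁ (∈P.∈-++⁺ˡ p)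
  AdjL-++⁺ˡ (inj₂ p) = inj₂ (∈P.∈-++⁺ˡ p)

  AdjL-++⁺ʳ : ∀ (A : List (Fin k × Fin k)) {B u v} → AdjL B u v → AdjL (A ++ B) u v
  AdjL-++⁺ʳ A (inj₁ p) = inj₁ (∈P.∈-++⁺ʳ A p)
  AdjL-++⁺ʳ A (inj₂ p) = inj₂ (∈P.∈-++⁺ʳ A p)

module _ {k m : ℕ} (f : Fin k → Fin m) where

  AdjL-map⁺ : ∀ {Es x y} → AdjL Es x y → AdjL (map (mapEdge f) Es) (f x) (f y)
  AdjL-map⁺ (inj₁ p) = inj₁ (∈P.∈-map⁺ (mapEdge f) p)
  AdjL-map⁺ (inj₂ p) = inj₂ (∈P.∈-map⁺ (mapEdge f) p)

  AdjL-map⁻ : ∀ {Es u w} → AdjL (map (mapEdge f) Es) u w → ∃₂ λ x y → u ≡ f x × w ≡ f y × AdjL Es x y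
  AdjL-map⁻ (inj₁ p) with ∈P.∈-map⁻ (mapEdge f) p
  ... | (x , y) , xy∈Es , refl = x , y , refl , refl , inj₁ xy∈Es
  AdjL-map⁻ (inj₂ p) with ∈P.∈-map⁻ (mapEdge f) p
  ... | (y , x) , yx∈Es , refl = x , y , refl , refl , inj₂ yx∈Es

Simple : ∀ {k} → List (Fin k × Fin k) → Set
Simple = AllPairs λ p q → ¬ SameEdge p q

module _ {k : ℕ} where

  simple⇒lookup-injective : ∀ {Es : List (Fin k × Fin k)} → Simple Es →
                            ∀ i j → SameEdge (lookup Es i) (lookup Es j) → i ≡ j
  simple⇒lookup-injective (_ ∷ _) zero zero _ = refl
  simple⇒lookup-injective (apart ∷ _) zero (suc j) same = ⊥-elim (All.lookup apart (∈P.∈-lookup j) same)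
  simple⇒lookup-injective (apart ∷ _) (suc i) zero same =
    ⊥-elim (All.lookup apart (∈P.∈-lookup i) (SameEdge-sym same))
  simple⇒lookup-injective (_ ∷ simple) (suc i) (suc j) same = cong suc (simple⇒lookup-injective simple i j same)

  lookup-injective⇒simple : ∀ (Es : List (Fin k × Fin k)) →
                            (∀ i j → SameEdge (lookup Es i) (lookup Es j) → i ≡ j) → Simple Es
  lookup-injective⇒simple [] _ = []
  lookup-injective⇒simple (p ∷ Es) injective =
    All.tabulate (λ q∈Es same →
      0≢1+ (injective zero (suc (Any.index q∈Es)) (subst (SameEdge p) (AnyP.lookup-index q∈Es) same)))
    ∷ lookup-injective⇒simple Es (λ i j same → FinP.suc-injective (injective (suc i) (suc j) same))
    where
    0≢1+ : ∀ {i : Fin (length Es)} → zero ≢ suc i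
    0≢1+ ()

  ≈E-intro : {A B : List (Fin k × Fin k)} → Simple A → Simple B →
             (∀ {p} → p ∈ A → ∃ λ q → q ∈ B × SameEdge p q) → (∀ {q} → q ∈ B → ∃ λ p → p ∈ A × SameEdge p q) →
             A ≈E B
  ≈E-intro {A} {B} simple-A simple-B A⊆B B⊆A = mk↔ₛ′ to from to∘from from∘to , same
    where
    to : Fin (length A) → Fin (length B)
    to i = Any.index (proj₁ (proj₂ (A⊆B (∈P.∈-lookup i))))
    from : Fin (length B) → Fin (length A)
    from j = Any.index (proj₁ (proj₂ (B⊆A (∈P.∈-lookup j))))
    same : ∀ i → SameEdge (lookup A i) (lookup B (to i))
    same i with A⊆B (∈P.∈-lookup i)
    ... | _ , q∈B , s = subst (SameEdge (lookup A i)) (AnyP.lookup-index q∈B) s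
    same′ : ∀ j → SameEdge (lookup A (from j)) (lookup B j)
    same′ j with B⊆A (∈P.∈-lookup j)
    ... | _ , p∈A , s = subst (λ p → SameEdge p (lookup B j)) (AnyP.lookup-index p∈A) s
    to∘from : ∀ j → to (from j) ≡ j
    to∘from j = simple⇒lookup-injective simple-B _ _ (SameEdge-trans (SameEdge-sym (same (from j))) (same′ j))
    from∘to : ∀ i → from (to i) ≡ i
    from∘to i = simple⇒lookup-injective simple-A _ _ (SameEdge-trans (same′ (to i)) (SameEdge-sym (same i)))

∈-removeAt⁺ : ∀ {A : Set} {xs : List A} {i x} (x∈xs : x ∈ xs) → Any.index x∈xs ≢ i → x ∈ removeAt xs i
∈-removeAt⁺ {i = zero} (here _) index≢i = ⊥-elim (index≢i refl)
∈-removeAt⁺ {i = suc _} (here x≡y) _ = here x≡y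
∈-removeAt⁺ {i = zero} (there x∈xs) _ = x∈xs
∈-removeAt⁺ {xs = _ ∷ _ ∷ _} {i = suc _} (there x∈xs) index≢i = there (∈-removeAt⁺ x∈xs (index≢i ∘ cong suc))

lookup-∈-removeAt : ∀ {A : Set} (xs : List A) {i j} → j ≢ i → lookup xs j ∈ removeAt xs i
lookup-∈-removeAt (_ ∷ _) {zero} {zero} j≢i = ⊥-elim (j≢i refl)
lookup-∈-removeAt (_ ∷ _) {zero} {suc j} _ = ∈P.∈-lookup j
lookup-∈-removeAt (_ ∷ _) {suc _} {zero} _ = here refl
lookup-∈-removeAt (_ ∷ xs) {suc _} {suc _} j≢i = there (lookup-∈-removeAt xs (j≢i ∘ cong suc))

module _ {k : ℕ} {Es : List (Fin k × Fin k)} where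

  AdjL-removeAt : ∀ {i u v} → AdjL Es u v → ¬ SameEdge (lookup Es i) (u , v) → AdjL (removeAt Es i) u v
  AdjL-removeAt {i} (inj₁ uv∈Es) ¬same with Any.index uv∈Es ≟ i
  ... | no index≢i = inj₁ (∈-removeAt⁺ uv∈Es index≢i)
  ... | yes refl = ⊥-elim (¬same (subst (λ q → SameEdge q _) (AnyP.lookup-index uv∈Es) (inj₁ (refl , refl))))
  AdjL-removeAt {i} (inj₂ vu∈Es) ¬same with Any.index vu∈Es ≟ i
  ... | no index≢i = inj₂ (∈-removeAt⁺ vu∈Es index≢i)
  ... | yes refl = ⊥-elim (¬same (subst (λ q → SameEdge q _) (AnyP.lookup-index vu∈Es) (inj₂ (refl , refl))))

  AdjL-removeAt-parallel : ∀ {i j u v} → j ≢ i → SameEdge (lookup Es i) (lookup Es j) →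
                           AdjL Es u v → AdjL (removeAt Es i) u v
  AdjL-removeAt-parallel {i} {j} {u} {v} j≢i i∥j uv with SameEdge? (lookup Es i) (u , v)
  ... | no ¬same = AdjL-removeAt uv ¬same
  ... | yes same = SameEdge⇒AdjL (lookup-∈-removeAt Es j≢i) (SameEdge-trans (SameEdge-sym i∥j) same)

-- Walks, Hamiltonian paths and Hamiltonian cycles

data Walk {V : Set} (R : V → V → Set) : V → V → List V → Set where
  stop : ∀ {a} → Walk R a a (a ∷ [])
  move : ∀ {a b c L} → R a b → Walk R b c L → Walk R a c (a ∷ L)

data Consecutive {A : Set} : List A → A → A → Set where
  now : ∀ {u v L} → Consecutive (u ∷ v ∷ L) u v
  later : ∀ {w u v L} → Consecutive L u v → Consecutive (w ∷ L) u v

module _ {V : Set} {R : V → V → Set} where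

  walk-head : ∀ {a b L} → Walk R a b L → ∃ λ M → L ≡ a ∷ M
  walk-head stop = [] , refl
  walk-head (move _ _) = _ , refl

  walk-start∈ : ∀ {a b L} → Walk R a b L → a ∈ L
  walk-start∈ stop = here refl
  walk-start∈ (move _ _) = here refl

  walk-end∈ : ∀ {a b L} → Walk R a b L → b ∈ L
  walk-end∈ stop = here refl
  walk-end∈ (move _ w) = there (walk-end∈ w)

  walk-++ : ∀ {a b c L₁ L₂} → Walk R a b L₁ → Walk R b c (b ∷ L₂) → Walk R a c (L₁ ++ L₂)
  walk-++ stop w₂ = w₂
  walk-++ (move r w₁) w₂ = move r (walk-++ w₁ w₂)

  walk-reverse : (∀ {x y} → R x y → R y x) → ∀ {a b L} → Walk R a b L → Walk R b a (reverse L)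
  walk-reverse R-sym stop = stop
  walk-reverse R-sym {L = a ∷ L} (move r w) = subst (Walk R _ a) (sym (ListP.unfold-reverse a L))
    (walk-++ (walk-reverse R-sym w) (move (R-sym r) stop))

  walk-consecutive : ∀ {a b L u v} → Walk R a b L → Consecutive L u v → R u v
  walk-consecutive (move r w) now with walk-head w
  ... | _ , refl = r
  walk-consecutive (move r w) (later c) = walk-consecutive w c

  walk-lookup-last : ∀ {a b y L} → Walk R a b (y ∷ L) → lookup (y ∷ L) (fromℕ (length L)) ≡ b
  walk-lookup-last stop = refl
  walk-lookup-last (move _ w) with walk-head w
  ... | _ , refl = walk-lookup-last w

  walk-replace : ∀ {R′ : V → V → Set} {a b L} → Walk R a b L →
                 (∀ {u v} → Consecutive L u v → R′ u v) → Walk R′ a b L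
  walk-replace stop _ = stop
  walk-replace (move r w) R′-steps with walk-head w
  ... | _ , refl = move (R′-steps now) (walk-replace w (R′-steps ∘ later))

walk-map : ∀ {V W : Set} {R : V → V → Set} {R′ : W → W → Set} (f : V → W) →
           (∀ {x y} → R x y → R′ (f x) (f y)) → ∀ {a b L} → Walk R a b L → Walk R′ (f a) (f b) (map f L)
walk-map f f-R stop = stop
walk-map f f-R (move r w) = move (f-R r) (walk-map f f-R w)

unique-reverse : ∀ {A : Set} {xs : List A} → Unique xs → Unique (reverse xs)
unique-reverse {A} {xs} = PermutationₛP.Unique-resp-↭ (setoid A) (↭⇒↭ₛ (↭-sym (↭-reverse xs)))

lookup-injective : ∀ {A : Set} {xs : List A} → Unique xs → ∀ i j → lookup xs i ≡ lookup xs j → i ≡ j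
lookup-injective (_ ∷ _) zero zero _ = refl
lookup-injective (x∉xs ∷ _) zero (suc j) e = ⊥-elim (All.lookup x∉xs (∈P.∈-lookup j) e)
lookup-injective (x∉xs ∷ _) (suc i) zero e = ⊥-elim (All.lookup x∉xs (∈P.∈-lookup i) (sym e))
lookup-injective (_ ∷ unique) (suc i) (suc j) e = cong suc (lookup-injective unique i j e)

record HamPath (H : Graph) (a b : Vertex H) : Set where
  constructor hamPath
  field
    vertices : List (Vertex H)
    walk : Walk (Adj H) a b vertices
    unique : Unique vertices
    spanning : ∀ v → v ∈ vertices

-- The closed walk runs base ∷ vertices, so vertices lists every vertex once and ends with base.
record HamCycle (H : Graph) : Set where
  constructor hamCycle
  field
    3≤n : 3 ≤ n H
    base : Vertex H
    vertices : List (Vertex H)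
    walk : Walk (Adj H) base base (base ∷ vertices)
    unique : Unique vertices
    spanning : ∀ v → v ∈ vertices

module _ {H′ H : Graph} (f : Vertex H′ → Vertex H) (f-injective : ∀ x y → f x ≡ f y → x ≡ y)
         (f-adj : ∀ {x y} → Adj H′ x y → Adj H (f x) (f y)) (f-onto : ∀ v → ∃ λ x → f x ≡ v) where

  private
    map-spanning : ∀ {L} → (∀ x → x ∈ L) → ∀ v → v ∈ map f L
    map-spanning spanning v with f-onto v
    ... | x , refl = ∈P.∈-map⁺ f (spanning x)

  hamPath-map : ∀ {a b} → HamPath H′ a b → HamPath H (f a) (f b)
  hamPath-map (hamPath L walk unique spanning) =
    hamPath (map f L) (walk-map f f-adj walk) (UniqueP.map⁺ (f-injective _ _) unique) (map-spanning spanning)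

  hamCycle-map : HamCycle H′ → HamCycle H
  hamCycle-map (hamCycle 3≤n x L walk unique spanning) =
    hamCycle (ℕP.≤-trans 3≤n (FinP.injective⇒≤ (f-injective _ _))) (f x) (map f L) (walk-map f f-adj walk)
             (UniqueP.map⁺ (f-injective _ _) unique) (map-spanning spanning)

module _ {H : Graph} where

  disjoint-walks⇒hamCycle : ∀ {a b M N} → 3 ≤ n H → Walk (Adj H) a b (a ∷ M) → Walk (Adj H) b a (b ∷ N) →
    Unique (a ∷ M) → Unique (b ∷ N) → (∀ {v} → ¬ (v ∈ M × v ∈ N)) → (∀ v → v ∈ M ⊎ v ∈ N) → HamCycle H
  disjoint-walks⇒hamCycle {a} {b} {M} 3≤n forth back (_ ∷ unique-M) (_ ∷ unique-N) disjoint cover =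
    hamCycle 3≤n a (M ++ _) (walk-++ forth back) (UniqueP.++⁺ unique-M unique-N disjoint)
             (λ v → [ ∈P.∈-++⁺ˡ , ∈P.∈-++⁺ʳ M ] (cover v))

  hamPath-close : ∀ {a b c} → HamPath H a b → Adj H b a → a ≢ b → ¬ Terminal a b c → HamCycle H
  hamPath-close {a} (hamPath L walk unique spanning) ba a≢b c∉ab with walk-head walk
  ... | M , refl = disjoint-walks⇒hamCycle (three-distinct⇒3≤ a≢b c∉ab) walk (move ba stop) unique
    (((λ b≡a → a≢b (sym b≡a)) ∷ []) ∷ [] ∷ [])
    (λ { (v∈M , here refl) → All.lookup (AllPairs.head unique) v∈M refl })
    (λ v → case spanning v of λ { (here refl) → inj₂ (here refl) ; (there v∈M) → inj₁ v∈M })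

  internally-disjoint⇒hamCycle : ∀ {a b c L₁ L₂} → Walk (Adj H) a b L₁ → Unique L₁ →
    Walk (Adj H) a b L₂ → Unique L₂ → (∀ {v} → v ∈ L₁ → v ∈ L₂ → Terminal a b v) →
    (∀ v → v ∈ L₁ ⊎ v ∈ L₂) → a ≢ b → ¬ Terminal a b c → HamCycle H
  internally-disjoint⇒hamCycle {a} {b} {c} {L₁} {L₂} walk₁ unique₁ walk₂ unique₂ common cover a≢b c∉ab
    with walk-head walk₁ | walk-head (walk-reverse swap walk₂)
  ... | M , refl | N , rev≡ = disjoint-walks⇒hamCycle (three-distinct⇒3≤ a≢b c∉ab) walk₁
        (subst (Walk (Adj H) b a) rev≡ (walk-reverse swap walk₂)) unique₁ unique-bN disjoint cover′
    where
    unique-bN : Unique (b ∷ N)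
    unique-bN = subst Unique rev≡ (unique-reverse unique₂)
    ∈bN : ∀ {v} → v ∈ L₂ → v ∈ b ∷ N
    ∈bN v∈L₂ = subst (_ ∈_) rev≡ (AnyP.reverse⁺ v∈L₂)
    disjoint : ∀ {v} → ¬ (v ∈ M × v ∈ N)
    disjoint {v} (v∈M , v∈N) with common (there v∈M) (AnyP.reverse⁻ (subst (v ∈_) (sym rev≡) (there v∈N)))
    ... | inj₁ refl = All.lookup (AllPairs.head unique₁) v∈M refl
    ... | inj₂ refl = All.lookup (AllPairs.head unique-bN) v∈N refl
    cover′ : ∀ v → v ∈ M ⊎ v ∈ N
    cover′ v with cover v
    ... | inj₁ (there v∈M) = inj₁ v∈M
    ... | inj₁ (here refl) with ∈bN (walk-start∈ walk₂)
    ... | here a≡b = ⊥-elim (a≢b a≡b)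
    ... | there a∈N = inj₂ a∈N
    cover′ v | inj₂ v∈L₂ with ∈bN v∈L₂
    ... | there v∈N = inj₂ v∈N
    ... | here refl with walk-end∈ walk₁
    ...   | here b≡a = ⊥-elim (a≢b (sym b≡a))
    ...   | there b∈M = inj₁ b∈M

-- Series–parallel decompositions

TerminalsOnly : ∀ {k} → Fin k → Fin k → Set
TerminalsOnly a b = ∀ v → Terminal a b v

terminalsOnly? : ∀ {k} (a b : Fin k) → Dec (TerminalsOnly a b)
terminalsOnly? a b = FinP.all? λ v → (v ≟ a) ⊎-dec (v ≟ b)

interior : ∀ {k} {a b : Fin k} → ¬ TerminalsOnly a b → ∃ λ x → ¬ Terminal a b x
interior {k} {a} {b} = FinP.¬∀⟶∃¬ k (Terminal a b) λ v → (v ≟ a) ⊎-dec (v ≟ b)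

record Join (G₁ G₂ H : Graph) : Set where
  constructor mkJoin
  field
    f₁ : Vertex G₁ → Vertex H
    f₂ : Vertex G₂ → Vertex H
    f₁-injective : ∀ x y → f₁ x ≡ f₁ y → x ≡ y
    f₂-injective : ∀ x y → f₂ x ≡ f₂ y → x ≡ y
    covers : ∀ v → (∃ λ x → f₁ x ≡ v) ⊎ (∃ λ y → f₂ y ≡ v)
    edges : (map (mapEdge f₁) (E G₁) ++ map (mapEdge f₂) (E G₂)) ≈E E H

  adj₁ : ∀ {x y} → Adj G₁ x y → Adj H (f₁ x) (f₁ y)
  adj₁ a = ≈E-AdjL edges (AdjL-++⁺ˡ (AdjL-map⁺ f₁ a))

  adj₂ : ∀ {x y} → Adj G₂ x y → Adj H (f₂ x) (f₂ y)
  adj₂ a = ≈E-AdjL edges (AdjL-++⁺ʳ (map (mapEdge f₁) (E G₁)) (AdjL-map⁺ f₂ a))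

  adj⁻ : ∀ {u w} → Adj H u w → (∃₂ λ x y → u ≡ f₁ x × w ≡ f₁ y × Adj G₁ x y)
                               ⊎ (∃₂ λ x y → u ≡ f₂ x × w ≡ f₂ y × Adj G₂ x y)
  adj⁻ a = Sum.map (AdjL-map⁻ f₁) (AdjL-map⁻ f₂) (AdjL-++⁻ (map (mapEdge f₁) (E G₁))
             (≈E-AdjL (≈E-sym {A = map (mapEdge f₁) (E G₁) ++ _} {B = E H} edges) a))

  closed₁ : ∀ {x w} → (∀ y → f₁ x ≢ f₂ y) → Adj H (f₁ x) w → ∃ λ z → w ≡ f₁ z × Adj G₁ x z
  closed₁ unglued a with adj⁻ a
  ... | inj₁ (_ , z , e , refl , a′) = z , refl , subst (λ x → Adj G₁ x z) (sym (f₁-injective _ _ e)) a′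
  ... | inj₂ (y , _ , e , _ , _) = ⊥-elim (unglued y e)

  closed₂ : ∀ {y w} → (∀ x → f₁ x ≢ f₂ y) → Adj H (f₂ y) w → ∃ λ z → w ≡ f₂ z × Adj G₂ y z
  closed₂ unglued a with adj⁻ a
  ... | inj₁ (x , _ , e , _ , _) = ⊥-elim (unglued x (sym e))
  ... | inj₂ (_ , z , e , refl , a′) = z , refl , subst (λ y → Adj G₂ y z) (sym (f₂-injective _ _ e)) a′

record SeriesJoin (G₁ : Graph) (s₁ t₁ : Vertex G₁) (G₂ : Graph) (s₂ t₂ : Vertex G₂) (H : Graph) : Set where
  constructor mkSeries
  field
    join : Join G₁ G₂ H
  open Join join public
  field
    meet : ∀ x y → f₁ x ≡ f₂ y → x ≡ t₁ × y ≡ s₂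
    junction : f₁ t₁ ≡ f₂ s₂

record ParallelJoin (G₁ : Graph) (s₁ t₁ : Vertex G₁) (G₂ : Graph) (s₂ t₂ : Vertex G₂) (H : Graph) : Set where
  constructor mkParallel
  field
    join : Join G₁ G₂ H
  open Join join public
  field
    meet : ∀ x y → f₁ x ≡ f₂ y → (x ≡ s₁ × y ≡ s₂) ⊎ (x ≡ t₁ × y ≡ t₂)
    source : f₂ s₂ ≡ f₁ s₁
    sink : f₂ t₂ ≡ f₁ t₁

module _ {H : Graph} {s t : Vertex H} (φ : Fin 2 ↔ Vertex H)
         (φ0 : Inverse.to φ zero ≡ s) (φ1 : Inverse.to φ (suc zero) ≡ t) where

  edge-terminalsOnly : TerminalsOnly s t
  edge-terminalsOnly v with Inverse.from φ v | Inverse.strictlyInverseˡ φ v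
  ... | zero | φ0≡v = inj₁ (trans (sym φ0≡v) φ0)
  ... | suc zero | φ1≡v = inj₂ (trans (sym φ1≡v) φ1)

  edge-distinct : s ≢ t
  edge-distinct s≡t with trans (sym (Inverse.strictlyInverseʳ φ zero))
                           (trans (cong (Inverse.from φ) (trans φ0 (trans s≡t (sym φ1))))
                                  (Inverse.strictlyInverseʳ φ (suc zero)))
  ... | ()

  edge-adjacent : map (mapEdge (Inverse.to φ)) (E K₂) ≈E E H → Adj H s t
  edge-adjacent edges rewrite sym φ0 | sym φ1 = ≈E-AdjL edges (inj₁ (here refl))

  edge-hamPath : map (mapEdge (Inverse.to φ)) (E K₂) ≈E E H → HamPath H s t
  edge-hamPath edges = hamPath (s ∷ t ∷ []) (move (edge-adjacent edges) stop) ((edge-distinct ∷ []) ∷ [] ∷ [])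
    λ v → [ Any.here , Any.there ∘ Any.here ]′ (edge-terminalsOnly v)

terminals-distinct : ∀ {H s t} → IsSP H s t → s ≢ t
terminals-distinct (edge H _ _ φ φ0 φ1 _) = edge-distinct {H} φ φ0 φ1
terminals-distinct (series _ _ _ _ _ _ sp₁ _ _ _ _ _ _ _ _ _ meet _ refl refl _) s≡t =
  terminals-distinct sp₁ (proj₁ (meet _ _ s≡t))
terminals-distinct (parallel _ _ _ _ _ _ sp₁ _ _ _ _ _ _ f₁-injective _ _ _ refl _ refl _ _) s≡t =
  terminals-distinct sp₁ (f₁-injective _ _ s≡t)

terminalsOnly⇒adjacent : ∀ {H s t} → IsSP H s t → TerminalsOnly s t → Adj H s t
terminalsOnly⇒adjacent (edge H _ _ φ φ0 φ1 edges) _ = edge-adjacent {H} φ φ0 φ1 edges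
terminalsOnly⇒adjacent (series _ _ t₁ _ _ _ sp₁ sp₂ _ _ _ f₁ _ f₁-inj f₂-inj _ _ junction refl refl _) only
  with only (f₁ t₁)
... | inj₁ t₁↦s = ⊥-elim (terminals-distinct sp₁ (sym (f₁-inj _ _ t₁↦s)))
... | inj₂ t₁↦t = ⊥-elim (terminals-distinct sp₂ (f₂-inj _ _ (trans (sym junction) t₁↦t)))
terminalsOnly⇒adjacent (parallel _ _ _ _ _ _ sp₁ _ _ _ _ f₁ f₂ f₁-inj f₂-inj covers _ refl _ refl _ edges) only =
  Join.adj₁ (mkJoin f₁ f₂ f₁-inj f₂-inj covers edges)
    (terminalsOnly⇒adjacent sp₁ λ x → Sum.map (f₁-inj _ _) (f₁-inj _ _) (only (f₁ x)))

terminalsOnly⇒cutsetFree : ∀ {H s t} → TerminalsOnly s t → Adj H s t → ∀ S k → ¬ Cutset H S k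
terminalsOnly⇒cutsetFree {H} only st S (suc (suc k)) ((r , r∉S , r-sep , _) , _) =
  0≢1 (r-sep zero (suc zero) (joined (r∉S zero) (r∉S (suc zero)) (only (r zero)) (only (r (suc zero)))))
  where
  0≢1 : zero {suc k} ≢ suc zero
  0≢1 ()
  joined : ∀ {u v} → u ∉ₛ S → v ∉ₛ S → Terminal _ _ u → Terminal _ _ v → Reach H S u v
  joined u∉S _ (inj₁ refl) (inj₁ refl) = here u∉S
  joined u∉S _ (inj₂ refl) (inj₂ refl) = here u∉S
  joined u∉S v∉S (inj₁ refl) (inj₂ refl) = step u∉S st (here v∉S)
  joined u∉S v∉S (inj₂ refl) (inj₁ refl) = step u∉S (swap st) (here v∉S)
terminalsOnly⇒cutsetFree only st S (suc zero) (_ , s≤s ())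
terminalsOnly⇒cutsetFree only st S zero (_ , ())

record Attached (G H : Graph) (Boundary : Vertex H → Set) (g : Vertex H → Vertex G) : Set where
  field
    injective : ∀ x y → g x ≡ g y → x ≡ y
    closed : ∀ {x w} → ¬ Boundary x → Adj G (g x) w → ∃ λ z → w ≡ g z × Adj H x z

Exterior : ∀ {k m} → (Fin m → Fin k) → Set
Exterior g = ∃ λ w → ∀ x → g x ≢ w

exterior-∘ : ∀ {k m l} {g : Fin m → Fin k} (f : Fin l → Fin m) → Exterior g → Exterior (g ∘ f)
exterior-∘ f (w , outside) = w , outside ∘ f

InnerImage : ∀ {k m} → (Fin m → Fin k) → (Fin m → Set) → Fin k → Set
InnerImage g B v = ∃ λ y → ¬ B y × v ≡ g y

attached-id : ∀ {G B} → Attached G G B id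
attached-id = record { injective = λ _ _ e → e ; closed = λ {_} {w} _ a → w , refl , a }

module _ {G G₁ G₂ H : Graph} {B : Vertex H → Set} {g : Vertex H → Vertex G}
         (att : Attached G H B g) (J : Join G₁ G₂ H) where
  open Join J
  open Attached att

  attached-join₁ : {B₁ : Vertex G₁ → Set} → (∀ {x} → ¬ B₁ x → ¬ B (f₁ x) × (∀ y → f₁ x ≢ f₂ y)) →
                   Attached G G₁ B₁ (g ∘ f₁)
  attached-join₁ inner = record
    { injective = λ x y e → f₁-injective x y (injective _ _ e)
    ; closed = λ x∉B₁ a → let z , w≡gz , a′ = closed (proj₁ (inner x∉B₁)) a
                              y , z≡f₁y , a″ = closed₁ (proj₂ (inner x∉B₁)) a′
                          in y , trans w≡gz (cong g z≡f₁y) , a″ }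

  attached-join₂ : {B₂ : Vertex G₂ → Set} → (∀ {y} → ¬ B₂ y → ¬ B (f₂ y) × (∀ x → f₁ x ≢ f₂ y)) →
                   Attached G G₂ B₂ (g ∘ f₂)
  attached-join₂ inner = record
    { injective = λ x y e → f₂-injective x y (injective _ _ e)
    ; closed = λ y∉B₂ a → let z , w≡gz , a′ = closed (proj₁ (inner y∉B₂)) a
                              y , z≡f₂y , a″ = closed₂ (proj₂ (inner y∉B₂)) a′
                          in y , trans w≡gz (cong g z≡f₂y) , a″ }

module _ {G H : Graph} {B : Vertex H → Set} {g : Vertex H → Vertex G} (att : Attached G H B g)
         {S : Subset (n G)} (boundary∈S : ∀ {x} → B x → g x ∈ₛ S) where
  open Attached att

  inner-closed : ∀ {u v} → InnerImage g B u → u ∉ₛ S → Adj G u v → v ∉ₛ S → InnerImage g B v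
  inner-closed (y , y∉B , refl) _ a v∉S with closed y∉B a
  ... | z , refl , _ = z , (λ z∈B → v∉S (boundary∈S z∈B)) , refl

  outside-closed : ∀ {u v} → (∀ x → g x ≢ u) → u ∉ₛ S → Adj G u v → v ∉ₛ S → ∀ x → g x ≢ v
  outside-closed u-out _ a v∉S x refl with closed (λ x∈B → v∉S (boundary∈S x∈B)) (swap a)
  ... | z , u≡gz , _ = u-out z (sym u≡gz)

module Series {G₁ s₁ t₁ G₂ s₂ t₂ H} (J : SeriesJoin G₁ s₁ t₁ G₂ s₂ t₂ H) where
  open SeriesJoin J

  module _ {G : Graph} {g : Vertex H → Vertex G} (att : Attached G H (Terminal (f₁ s₁) (f₂ t₂)) g) where

    attached₁ : Attached G G₁ (Terminal s₁ t₁) (g ∘ f₁)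
    attached₁ = attached-join₁ att join λ x∉ →
      [ x∉ ∘ inj₁ ∘ f₁-injective _ _ , x∉ ∘ inj₂ ∘ proj₁ ∘ meet _ _ ] , λ y → x∉ ∘ inj₂ ∘ proj₁ ∘ meet _ y

    attached₂ : Attached G G₂ (Terminal s₂ t₂) (g ∘ f₂)
    attached₂ = attached-join₂ att join λ y∉ →
      [ y∉ ∘ inj₁ ∘ proj₂ ∘ meet _ _ ∘ sym , y∉ ∘ inj₂ ∘ f₂-injective _ _ ] , λ x → y∉ ∘ inj₁ ∘ proj₂ ∘ meet x _

    exterior₁ : IsSP G₂ s₂ t₂ → Exterior (g ∘ f₁)
    exterior₁ sp₂ = g (f₂ t₂) , λ x e →
      terminals-distinct sp₂ (sym (proj₂ (meet _ _ (Attached.injective att _ _ e))))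

    exterior₂ : IsSP G₁ s₁ t₁ → Exterior (g ∘ f₂)
    exterior₂ sp₁ = g (f₁ s₁) , λ y e →
      terminals-distinct sp₁ (proj₁ (meet _ _ (sym (Attached.injective att _ _ e))))

  concat : HamPath G₁ s₁ t₁ → HamPath G₂ s₂ t₂ → HamPath H (f₁ s₁) (f₂ t₂)
  concat (hamPath L₁ walk₁ unique₁ spanning₁) (hamPath L₂ walk₂ unique₂ spanning₂)
    with walk-head walk₂ | unique₂
  ... | M₂ , refl | s₂∉M₂ ∷ unique-M₂ = hamPath (map f₁ L₁ ++ map f₂ M₂)
    (walk-++ (walk-map f₁ adj₁ walk₁)
             (subst (λ v → Walk (Adj H) v (f₂ t₂) (v ∷ map f₂ M₂)) (sym junction) (walk-map f₂ adj₂ walk₂)))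
    (UniqueP.++⁺ (UniqueP.map⁺ (f₁-injective _ _) unique₁) (UniqueP.map⁺ (f₂-injective _ _) unique-M₂)
                 disjoint)
    cover
    where
    disjoint : ∀ {v} → ¬ (v ∈ map f₁ L₁ × v ∈ map f₂ M₂)
    disjoint (p , q) with ∈P.∈-map⁻ f₁ p | ∈P.∈-map⁻ f₂ q
    ... | x , _ , refl | y , y∈M₂ , e = All.lookup s₂∉M₂ y∈M₂ (sym (proj₂ (meet x y e)))
    cover : ∀ v → v ∈ map f₁ L₁ ++ map f₂ M₂
    cover v with covers v
    ... | inj₁ (x , refl) = ∈P.∈-++⁺ˡ (∈P.∈-map⁺ f₁ (spanning₁ x))
    ... | inj₂ (y , refl) with spanning₂ y
    ...   | there y∈M₂ = ∈P.∈-++⁺ʳ (map f₁ L₁) (∈P.∈-map⁺ f₂ y∈M₂)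
    ...   | here refl = ∈P.∈-++⁺ˡ (subst (_∈ map f₁ L₁) junction (∈P.∈-map⁺ f₁ (spanning₁ t₁)))

module Parallel {G₁ s₁ t₁ G₂ s₂ t₂ H} (P : ParallelJoin G₁ s₁ t₁ G₂ s₂ t₂ H) where
  open ParallelJoin P

  unglued₁ : ∀ {x} → ¬ Terminal s₁ t₁ x → ∀ y → f₁ x ≢ f₂ y
  unglued₁ x∉ y e = x∉ (Sum.map proj₁ proj₁ (meet _ _ e))

  unglued₂ : ∀ {y} → ¬ Terminal s₂ t₂ y → ∀ x → f₁ x ≢ f₂ y
  unglued₂ y∉ x e = y∉ (Sum.map proj₂ proj₂ (meet _ _ e))

  terminal₁ : ∀ {x} → Terminal (f₁ s₁) (f₁ t₁) (f₁ x) → Terminal s₁ t₁ x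
  terminal₁ = Sum.map (f₁-injective _ _) (f₁-injective _ _)

  terminal₂ : ∀ {y} → Terminal (f₁ s₁) (f₁ t₁) (f₂ y) → Terminal s₂ t₂ y
  terminal₂ = [ Sum.map proj₂ proj₂ ∘ meet _ _ ∘ sym , Sum.map proj₂ proj₂ ∘ meet _ _ ∘ sym ]

  terminal₂⁺ : ∀ {y} → Terminal s₂ t₂ y → Terminal (f₁ s₁) (f₁ t₁) (f₂ y)
  terminal₂⁺ = Sum.map (λ { refl → source }) (λ { refl → sink })

  onto₁ : TerminalsOnly s₂ t₂ → ∀ v → ∃ λ x → f₁ x ≡ v
  onto₁ only₂ v with covers v
  ... | inj₁ x↦v = x↦v
  ... | inj₂ (y , refl) = [ (λ { refl → s₁ , sym source }) , (λ { refl → t₁ , sym sink }) ] (only₂ y)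

  onto₂ : TerminalsOnly s₁ t₁ → ∀ v → ∃ λ y → f₂ y ≡ v
  onto₂ only₁ v with covers v
  ... | inj₂ y↦v = y↦v
  ... | inj₁ (x , refl) = [ (λ { refl → s₂ , source }) , (λ { refl → t₂ , sink }) ] (only₁ x)

  terminalsOnly : TerminalsOnly s₁ t₁ → TerminalsOnly s₂ t₂ → TerminalsOnly (f₁ s₁) (f₁ t₁)
  terminalsOnly only₁ only₂ v with onto₁ only₂ v
  ... | x , refl = Sum.map (cong f₁) (cong f₁) (only₁ x)

  module _ {G : Graph} {g : Vertex H → Vertex G} (att : Attached G H (Terminal (f₁ s₁) (f₁ t₁)) g) where

    attached₁ : Attached G G₁ (Terminal s₁ t₁) (g ∘ f₁)
    attached₁ = attached-join₁ att join λ x∉ → x∉ ∘ terminal₁ , unglued₁ x∉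

    attached₂ : Attached G G₂ (Terminal s₂ t₂) (g ∘ f₂)
    attached₂ = attached-join₂ att join λ y∉ → y∉ ∘ terminal₂ , unglued₂ y∉

    exterior₁ : ∀ {y} → ¬ Terminal s₂ t₂ y → Exterior (g ∘ f₁)
    exterior₁ {y} y∉ = g (f₂ y) , λ x e → unglued₂ y∉ x (Attached.injective att _ _ e)

    exterior₂ : ∀ {x} → ¬ Terminal s₁ t₁ x → Exterior (g ∘ f₂)
    exterior₂ {x} x∉ = g (f₁ x) , λ y e → unglued₁ x∉ y (sym (Attached.injective att _ _ e))

  lift₁ : TerminalsOnly s₂ t₂ → HamPath G₁ s₁ t₁ → HamPath H (f₁ s₁) (f₁ t₁)
  lift₁ only₂ = hamPath-map f₁ f₁-injective adj₁ (onto₁ only₂)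

  lift₂ : TerminalsOnly s₁ t₁ → HamPath G₂ s₂ t₂ → HamPath H (f₁ s₁) (f₁ t₁)
  lift₂ only₁ p = subst₂ (HamPath H) source sink (hamPath-map f₂ f₂-injective adj₂ (onto₂ only₁) p)

  close₁ : IsSP G₁ s₁ t₁ → IsSP G₂ s₂ t₂ → TerminalsOnly s₂ t₂ → ∀ {x} → ¬ Terminal s₁ t₁ x →
           HamPath G₁ s₁ t₁ ⊎ HamCycle G₁ → HamCycle H
  close₁ sp₁ sp₂ only₂ x∉ =
    [ (λ p → hamPath-close (lift₁ only₂ p) (swap ts) (terminals-distinct sp₁ ∘ f₁-injective _ _) (x∉ ∘ terminal₁))
    , hamCycle-map f₁ f₁-injective adj₁ (onto₁ only₂) ]
    where ts = subst₂ (Adj H) source sink (adj₂ (terminalsOnly⇒adjacent sp₂ only₂))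

  close₂ : IsSP G₁ s₁ t₁ → IsSP G₂ s₂ t₂ → TerminalsOnly s₁ t₁ → ∀ {y} → ¬ Terminal s₂ t₂ y →
           HamPath G₂ s₂ t₂ ⊎ HamCycle G₂ → HamCycle H
  close₂ sp₁ sp₂ only₁ y∉ =
    [ (λ p → hamPath-close (lift₂ only₁ p) (swap ts) (terminals-distinct sp₁ ∘ f₁-injective _ _) (y∉ ∘ terminal₂))
    , hamCycle-map f₂ f₂-injective adj₂ (onto₂ only₁) ]
    where ts = adj₁ (terminalsOnly⇒adjacent sp₁ only₁)

  glue : IsSP G₁ s₁ t₁ → ∀ {x} → ¬ Terminal s₁ t₁ x → HamPath G₁ s₁ t₁ → HamPath G₂ s₂ t₂ → HamCycle H
  glue sp₁ x∉ (hamPath L₁ walk₁ unique₁ spanning₁) (hamPath L₂ walk₂ unique₂ spanning₂) =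
    internally-disjoint⇒hamCycle
      (walk-map f₁ adj₁ walk₁) (UniqueP.map⁺ (f₁-injective _ _) unique₁)
      (subst₂ (λ a b → Walk (Adj H) a b (map f₂ L₂)) source sink (walk-map f₂ adj₂ walk₂))
      (UniqueP.map⁺ (f₂-injective _ _) unique₂)
      common cover (terminals-distinct sp₁ ∘ f₁-injective _ _) (x∉ ∘ terminal₁)
    where
    common : ∀ {v} → v ∈ map f₁ L₁ → v ∈ map f₂ L₂ → Terminal (f₁ s₁) (f₁ t₁) v
    common p q with ∈P.∈-map⁻ f₁ p | ∈P.∈-map⁻ f₂ q
    ... | x , _ , refl | y , _ , e = Sum.map (cong f₁ ∘ proj₁) (cong f₁ ∘ proj₁) (meet x y e)
    cover : ∀ v → v ∈ map f₁ L₁ ⊎ v ∈ map f₂ L₂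
    cover v with covers v
    ... | inj₁ (x , refl) = inj₁ (∈P.∈-map⁺ f₁ (spanning₁ x))
    ... | inj₂ (y , refl) = inj₂ (∈P.∈-map⁺ f₂ (spanning₂ y))

-- Hamiltonicity of 1-tough series–parallel graphs

module _ {G : Graph} (tough : IsTough G 1ℚ) where

  -- The junction of a series decomposition of G would be a cut vertex.
  series-cut : ∀ {G₁ s₁ t₁ G₂ s₂ t₂} → IsSP G₁ s₁ t₁ → IsSP G₂ s₂ t₂ → ¬ SeriesJoin G₁ s₁ t₁ G₂ s₂ t₂ G
  series-cut {G₁} {s₁} {t₁} {G₂} {s₂} {t₂} sp₁ sp₂ J = ℕP.<-irrefl refl
    (subst (2 ≤_) (SubP.∣⁅x⁆∣≡1 (f₁ t₁)) (1-tough⇒separated≤ tough separated (s≤s (s≤s z≤n))))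
    where
    open SeriesJoin J
    S = ⁅ f₁ t₁ ⁆
    att₁ : Attached G G₁ (_≡ t₁) f₁
    att₁ = attached-join₁ (attached-id {B = λ _ → ⊥}) join λ x≢t₁ → (λ ()) , λ y → x≢t₁ ∘ proj₁ ∘ meet _ y
    att₂ : Attached G G₂ (_≡ s₂) f₂
    att₂ = attached-join₂ (attached-id {B = λ _ → ⊥}) join λ y≢s₂ → (λ ()) , λ x → y≢s₂ ∘ proj₂ ∘ meet x _
    side : Fin 2 → Vertex G → Set
    side zero = InnerImage f₁ (_≡ t₁)
    side (suc zero) = InnerImage f₂ (_≡ s₂)
    r = f₁ s₁ ∷ᵛ f₂ t₂ ∷ᵛ []ᵛ
    separated : Separated {G} {S} 2 r
    separated = separated-by side
      (λ { zero → inner-closed att₁ λ { refl → SubP.x∈⁅x⁆ _ }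
         ; (suc zero) → inner-closed att₂ λ { refl → subst (_∈ₛ S) junction (SubP.x∈⁅x⁆ _) } })
      (λ { zero → s₁ , terminals-distinct sp₁ , refl ; (suc zero) → t₂ , terminals-distinct sp₂ ∘ sym , refl })
      (λ { zero zero _ → refl
         ; zero (suc zero) (y , _ , e) → ⊥-elim (terminals-distinct sp₂ (sym (proj₂ (meet y _ (sym e)))))
         ; (suc zero) zero (y , _ , e) → ⊥-elim (terminals-distinct sp₁ (proj₁ (meet _ y e)))
         ; (suc zero) (suc zero) _ → refl })
      (λ { zero p → terminals-distinct sp₁ (f₁-injective _ _ (SubP.x∈⁅y⁆⇒x≡y _ p))
         ; (suc zero) p → terminals-distinct sp₂ (sym (f₂-injective _ _ (trans (SubP.x∈⁅y⁆⇒x≡y _ p) junction))) })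

  -- Deleting the two terminals would separate the inner vertices of both sides and the exterior.
  parallel-interiors-split : ∀ {G₁ s₁ t₁ G₂ s₂ t₂ H} {g : Vertex H → Vertex G}
    (P : ParallelJoin G₁ s₁ t₁ G₂ s₂ t₂ H) →
    let open ParallelJoin P in Attached G H (Terminal (f₁ s₁) (f₁ t₁)) g → Exterior g →
    ∀ {x y} → ¬ Terminal s₁ t₁ x → ¬ Terminal s₂ t₂ y → ⊥
  parallel-interiors-split {G₁} {s₁} {t₁} {G₂} {s₂} {t₂} {H} {g} P att (w , w-out) {x} {y} x∉ y∉ =
    ℕP.<-irrefl refl (ℕP.≤-trans (1-tough⇒separated≤ tough separated (s≤s (s≤s z≤n)))
                                 (∣⁅x⁆∪⁅y⁆∣≤2 (g (f₁ s₁)) (g (f₁ t₁))))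
    where
    open ParallelJoin P
    open Parallel P
    S = ⁅ g (f₁ s₁) ⁆ ∪ ⁅ g (f₁ t₁) ⁆
    terminal∈S : ∀ {v} → Terminal (f₁ s₁) (f₁ t₁) v → g v ∈ₛ S
    terminal∈S (inj₁ refl) = SubP.x∈p∪q⁺ (inj₁ (SubP.x∈⁅x⁆ _))
    terminal∈S (inj₂ refl) = SubP.x∈p∪q⁺ (inj₂ (SubP.x∈⁅x⁆ _))
    ∈S⇒terminal : ∀ {v} → g v ∈ₛ S → Terminal (f₁ s₁) (f₁ t₁) v
    ∈S⇒terminal p = Sum.map (Attached.injective att _ _ ∘ SubP.x∈⁅y⁆⇒x≡y _)
                            (Attached.injective att _ _ ∘ SubP.x∈⁅y⁆⇒x≡y _) (SubP.x∈p∪q⁻ ⁅ _ ⁆ ⁅ _ ⁆ p)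
    part : Fin 3 → Vertex G → Set
    part zero = InnerImage (g ∘ f₁) (Terminal s₁ t₁)
    part (suc zero) = InnerImage (g ∘ f₂) (Terminal s₂ t₂)
    part (suc (suc zero)) = λ v → ∀ z → g z ≢ v
    r = g (f₁ x) ∷ᵛ g (f₂ y) ∷ᵛ w ∷ᵛ []ᵛ
    separated : Separated {G} {S} 3 r
    separated = separated-by part
      (λ { zero → inner-closed (attached₁ att) (terminal∈S ∘ Sum.map (cong f₁) (cong f₁))
         ; (suc zero) → inner-closed (attached₂ att) (terminal∈S ∘ terminal₂⁺)
         ; (suc (suc zero)) → outside-closed att terminal∈S })
      (λ { zero → x , x∉ , refl ; (suc zero) → y , y∉ , refl ; (suc (suc zero)) → w-out })
      (λ { zero zero _ → refl
         ; zero (suc zero) (x′ , _ , e) → ⊥-elim (unglued₂ y∉ x′ (sym (Attached.injective att _ _ e)))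
         ; zero (suc (suc zero)) (x′ , _ , e) → ⊥-elim (w-out (f₁ x′) (sym e))
         ; (suc zero) zero (y′ , _ , e) → ⊥-elim (unglued₁ x∉ y′ (Attached.injective att _ _ e))
         ; (suc zero) (suc zero) _ → refl
         ; (suc zero) (suc (suc zero)) (y′ , _ , e) → ⊥-elim (w-out (f₂ y′) (sym e))
         ; (suc (suc zero)) zero outside → ⊥-elim (outside (f₁ x) refl)
         ; (suc (suc zero)) (suc zero) outside → ⊥-elim (outside (f₂ y) refl)
         ; (suc (suc zero)) (suc (suc zero)) _ → refl })
      (λ { zero p → x∉ (terminal₁ (∈S⇒terminal p))
         ; (suc zero) p → y∉ (terminal₂ (∈S⇒terminal p))
         ; (suc (suc zero)) p → [ (λ q → w-out _ (sym (SubP.x∈⁅y⁆⇒x≡y _ q)))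
                                , (λ q → w-out _ (sym (SubP.x∈⁅y⁆⇒x≡y _ q))) ]′ (SubP.x∈p∪q⁻ ⁅ _ ⁆ ⁅ _ ⁆ p) })

  attached⇒hamPath : ∀ {H a b} {g : Vertex H → Vertex G} → IsSP H a b → Attached G H (Terminal a b) g →
               Exterior g → HamPath H a b
  series-hamPath : ∀ {G₁ s₁ t₁ G₂ s₂ t₂ H} {g : Vertex H → Vertex G} (J : SeriesJoin G₁ s₁ t₁ G₂ s₂ t₂ H) →
    IsSP G₁ s₁ t₁ → IsSP G₂ s₂ t₂ → let open SeriesJoin J in
    Attached G H (Terminal (f₁ s₁) (f₂ t₂)) g → HamPath H (f₁ s₁) (f₂ t₂)
  parallel-hamPath : ∀ {G₁ s₁ t₁ G₂ s₂ t₂ H} {g : Vertex H → Vertex G} (P : ParallelJoin G₁ s₁ t₁ G₂ s₂ t₂ H) →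
    IsSP G₁ s₁ t₁ → IsSP G₂ s₂ t₂ → let open ParallelJoin P in
    Attached G H (Terminal (f₁ s₁) (f₁ t₁)) g → Exterior g → HamPath H (f₁ s₁) (f₁ t₁)
  parallel-hamCycle : ∀ {G₁ s₁ t₁ G₂ s₂ t₂ H} {g : Vertex H → Vertex G} (P : ParallelJoin G₁ s₁ t₁ G₂ s₂ t₂ H) →
    IsSP G₁ s₁ t₁ → IsSP G₂ s₂ t₂ → let open ParallelJoin P in
    Attached G H (Terminal (f₁ s₁) (f₁ t₁)) g → TerminalsOnly (f₁ s₁) (f₁ t₁) ⊎ HamCycle H
  attached⇒hamPath⊎hamCycle : ∀ {H a b} {g : Vertex H → Vertex G} → IsSP H a b → Attached G H (Terminal a b) g →
                ¬ TerminalsOnly a b → HamPath H a b ⊎ HamCycle H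

  attached⇒hamPath (edge H _ _ φ φ0 φ1 edges) _ _ = edge-hamPath {H} φ φ0 φ1 edges
  attached⇒hamPath (series _ _ _ _ _ _ sp₁ sp₂ _ _ _ f₁ f₂ f₁-inj f₂-inj covers meet junction refl refl edges) att _ =
    series-hamPath (mkSeries (mkJoin f₁ f₂ f₁-inj f₂-inj covers edges) meet junction) sp₁ sp₂ att
  attached⇒hamPath (parallel _ _ _ _ _ _ sp₁ sp₂ _ _ _ f₁ f₂ f₁-inj f₂-inj covers meet refl source refl sink edges) =
    parallel-hamPath (mkParallel (mkJoin f₁ f₂ f₁-inj f₂-inj covers edges) meet source sink) sp₁ sp₂

  series-hamPath J sp₁ sp₂ att =
    Series.concat J (attached⇒hamPath sp₁ (Series.attached₁ J att) (Series.exterior₁ J att sp₂))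
                    (attached⇒hamPath sp₂ (Series.attached₂ J att) (Series.exterior₂ J att sp₁))

  parallel-hamPath {G₁} {s₁} {t₁} {G₂} {s₂} {t₂} P sp₁ sp₂ att ext
    with terminalsOnly? s₁ t₁ | terminalsOnly? s₂ t₂
  ... | _ | yes only₂ =
    Parallel.lift₁ P only₂ (attached⇒hamPath sp₁ (Parallel.attached₁ P att) (exterior-∘ _ ext))
  ... | yes only₁ | no _ =
    Parallel.lift₂ P only₁ (attached⇒hamPath sp₂ (Parallel.attached₂ P att) (exterior-∘ _ ext))
  ... | no ¬only₁ | no ¬only₂ =
    ⊥-elim (parallel-interiors-split P att ext (proj₂ (interior ¬only₁)) (proj₂ (interior ¬only₂)))

  parallel-hamCycle {G₁} {s₁} {t₁} {G₂} {s₂} {t₂} P sp₁ sp₂ att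
    with terminalsOnly? s₁ t₁ | terminalsOnly? s₂ t₂
  ... | yes only₁ | yes only₂ = inj₁ (Parallel.terminalsOnly P only₁ only₂)
  ... | no ¬only₁ | yes only₂ = inj₂ (Parallel.close₁ P sp₁ sp₂ only₂ (proj₂ (interior ¬only₁))
                                        (attached⇒hamPath⊎hamCycle sp₁ (Parallel.attached₁ P att) ¬only₁))
  ... | yes only₁ | no ¬only₂ = inj₂ (Parallel.close₂ P sp₁ sp₂ only₁ (proj₂ (interior ¬only₂))
                                        (attached⇒hamPath⊎hamCycle sp₂ (Parallel.attached₂ P att) ¬only₂))
  ... | no ¬only₁ | no ¬only₂ = inj₂ (Parallel.glue P sp₁ (proj₂ (interior ¬only₁))
      (attached⇒hamPath sp₁ (Parallel.attached₁ P att) (Parallel.exterior₁ P att (proj₂ (interior ¬only₂))))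
      (attached⇒hamPath sp₂ (Parallel.attached₂ P att) (Parallel.exterior₂ P att (proj₂ (interior ¬only₁)))))

  attached⇒hamPath⊎hamCycle (edge H _ _ φ φ0 φ1 _) _ ¬only = ⊥-elim (¬only (edge-terminalsOnly {H} φ φ0 φ1))
  attached⇒hamPath⊎hamCycle (series _ _ _ _ _ _ sp₁ sp₂ _ _ _ f₁ f₂ f₁-inj f₂-inj covers meet junction refl refl edges) att _ =
    inj₁ (series-hamPath (mkSeries (mkJoin f₁ f₂ f₁-inj f₂-inj covers edges) meet junction) sp₁ sp₂ att)
  attached⇒hamPath⊎hamCycle (parallel _ _ _ _ _ _ sp₁ sp₂ _ _ _ f₁ f₂ f₁-inj f₂-inj covers meet refl source refl sink edges) att ¬only =
    [ ⊥-elim ∘ ¬only , inj₂ ]′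
      (parallel-hamCycle (mkParallel (mkJoin f₁ f₂ f₁-inj f₂-inj covers edges) meet source sink) sp₁ sp₂ att)

  1-tough⇒hamCycle : ∀ {s t} → IsSP G s t → ¬ TerminalsOnly s t → HamCycle G
  1-tough⇒hamCycle (edge H _ _ φ φ0 φ1 _) ¬only = ⊥-elim (¬only (edge-terminalsOnly {H} φ φ0 φ1))
  1-tough⇒hamCycle (series _ _ _ _ _ _ sp₁ sp₂ _ _ _ f₁ f₂ f₁-inj f₂-inj covers meet junction refl refl edges) _ =
    ⊥-elim (series-cut sp₁ sp₂ (mkSeries (mkJoin f₁ f₂ f₁-inj f₂-inj covers edges) meet junction))
  1-tough⇒hamCycle (parallel _ _ _ _ _ _ sp₁ sp₂ _ _ _ f₁ f₂ f₁-inj f₂-inj covers meet refl source refl sink edges) ¬only =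
    [ ⊥-elim ∘ ¬only , id ]′
      (parallel-hamCycle (mkParallel (mkJoin f₁ f₂ f₁-inj f₂-inj covers edges) meet source sink) sp₁ sp₂ attached-id)

toughness1⇒hamCycle : ∀ {G s t} → IsSP G s t → Toughness G 1ℚ → HamCycle G
toughness1⇒hamCycle {G} {s} {t} sp toughness = by-cases (terminalsOnly? s t)
  where
  by-cases : Dec (TerminalsOnly s t) → HamCycle G
  by-cases (yes only) =
    ⊥-elim (cutsetFree⇒¬toughness1 (terminalsOnly⇒cutsetFree only (terminalsOnly⇒adjacent sp only)) toughness)
  by-cases (no ¬only) = 1-tough⇒hamCycle (proj₁ toughness) sp ¬only

-- Toughness of Hamiltonian graphs

module _ {A : Set} where

  Closed : (A → Set) → List A → Set
  Closed X M = ∀ {u v} → Consecutive M u v → X u → X v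

  closed-∈ : ∀ {X a M} → Closed X (a ∷ M) → X a → ∀ {v} → v ∈ a ∷ M → X v
  closed-∈ closed Xa (here refl) = Xa
  closed-∈ {M = _ ∷ _} closed Xa (there v∈M) = closed-∈ (λ c → closed (later c)) (closed now Xa) v∈M

  closed-reaches-end : ∀ {R : A → A → Set} {X a b M} → Walk R a b M → Closed X M → ∀ {v} → v ∈ M → X v → X b
  closed-reaches-end stop _ (here refl) Xv = Xv
  closed-reaches-end (move _ w) closed (there v∈) Xv = closed-reaches-end w (λ c → closed (later c)) v∈ Xv
  closed-reaches-end (move _ w) closed (here refl) Xv with walk-head w
  ... | _ , refl = closed-reaches-end w (λ c → closed (later c)) (here refl) (closed now Xv)

  consecutive-∈ : ∀ {w u v : A} {L} → Consecutive (w ∷ L) u v → v ∈ L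
  consecutive-∈ now = here refl
  consecutive-∈ {L = _ ∷ _} (later c) = there (consecutive-∈ c)

  predecessor-unique : ∀ {y u u′ v : A} {L} → Unique L → Consecutive (y ∷ L) u v → Consecutive (y ∷ L) u′ v → u ≡ u′
  predecessor-unique _ now now = refl
  predecessor-unique (v∉L ∷ _) now (later c′) = ⊥-elim (All.lookup v∉L (consecutive-∈ c′) refl)
  predecessor-unique (v∉L ∷ _) (later c) now = ⊥-elim (All.lookup v∉L (consecutive-∈ c) refl)
  predecessor-unique (_ ∷ unique) (later c) (later c′) = predecessor-unique unique c c′

-- Every component of H − S is left along the cycle through its own vertex of S.
hamCycle⇒1-tough : ∀ {H} → HamCycle H → IsTough H 1ℚ
hamCycle⇒1-tough {H} (hamCycle _ x L walk unique spanning) = 1-tough⇐ bound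
  where
  bound : ∀ S k → Cutset H S k → k ≤ ∣ S ∣
  bound S (suc (suc k)) ((r , r∉S , r-sep , _) , _) =
    decidable-stable (suc (suc k) ≤? ∣ S ∣) (¬¬-map exits⇒bound (FinP.sequence rawApplicative exit))
    where
    Exit : Fin (suc (suc k)) → Set
    Exit i = ∃₂ λ u z → Reach H S (r i) u × Consecutive (x ∷ L) u z × z ∈ₛ S

    exit : ∀ i → ¬ ¬ Exit i
    exit i no-exit = 0≢1 (trans (sym (r-sep i zero (reached _))) (r-sep i (suc zero) (reached _)))
      where
      0≢1 : zero {suc k} ≢ suc zero
      0≢1 ()
      closed : Closed (Reach H S (r i)) (x ∷ L)
      closed {u} {z} c p with z SubP.∈? S
      ... | yes z∈S = ⊥-elim (no-exit (u , z , p , c , z∈S))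
      ... | no z∉S = reach-trans p (step (reach-end p) (walk-consecutive walk c) (here z∉S))
      reached : ∀ v → Reach H S (r i) v
      reached v = closed-∈ closed (closed-reaches-end walk closed (there (spanning (r i))) (here (r∉S i)))
                           (there (spanning v))

    exits⇒bound : (∀ i → Exit i) → suc (suc k) ≤ ∣ S ∣
    exits⇒bound exits = injective⇒≤∣p∣ S exit-vertex injective (λ i → proj₂ (proj₂ (proj₂ (proj₂ (exits i)))))
      where
      exit-vertex : Fin (suc (suc k)) → Vertex H
      exit-vertex i = proj₁ (proj₂ (exits i))
      injective : ∀ i j → exit-vertex i ≡ exit-vertex j → i ≡ j
      injective i j e with exits i | exits j
      ... | u , _ , p , c , _ | u′ , _ , p′ , c′ , _ = r-sep i j (reach-trans p
        (subst (λ w → Reach H S w (r j)) (predecessor-unique unique c′ (subst (Consecutive _ u) e c)) (reach-sym p′)))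
  bound S (suc zero) (_ , s≤s ())
  bound S zero (_ , ())

-- Cycle graphs

consecutive-tabulate⁻ : ∀ {A : Set} {k} (f : Fin (suc k) → A) {u v} → Consecutive (tabulate f) u v →
                        ∃ λ i → u ≡ f (inject₁ i) × v ≡ f (suc i)
consecutive-tabulate⁻ {k = zero} f (later ())
consecutive-tabulate⁻ {k = suc k} f now = zero , refl , refl
consecutive-tabulate⁻ {k = suc k} f (later c) with consecutive-tabulate⁻ (f ∘ suc) c
... | i , refl , refl = suc i , refl , refl

consecutive-tabulate⁺ : ∀ {A : Set} {k} (f : Fin (suc k) → A) (i : Fin k) →
                        Consecutive (tabulate f) (f (inject₁ i)) (f (suc i))
consecutive-tabulate⁺ f zero = now
consecutive-tabulate⁺ f (suc i) = later (consecutive-tabulate⁺ (f ∘ suc) i)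

module _ {A : Set} {k : ℕ} (f : Fin (suc k) → A) where

  consecutive-cycle⁻ : ∀ {u v} → Consecutive (f (fromℕ k) ∷ tabulate f) u v →
                       ∃ λ e → e ∈ E (cycleGraph (suc k)) × u ≡ f (proj₁ e) × v ≡ f (proj₂ e)
  consecutive-cycle⁻ now = (fromℕ k , zero) , ∈P.∈-++⁺ʳ _ (here refl) , refl , refl
  consecutive-cycle⁻ (later c) with consecutive-tabulate⁻ f c
  ... | i , refl , refl = (inject₁ i , suc i) , ∈P.∈-++⁺ˡ (∈P.∈-map⁺ _ (∈P.∈-allFin i)) , refl , refl

  consecutive-cycle⁺ : ∀ {e} → e ∈ E (cycleGraph (suc k)) →
                       Consecutive (f (fromℕ k) ∷ tabulate f) (f (proj₁ e)) (f (proj₂ e))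
  consecutive-cycle⁺ e∈ with ∈P.∈-++⁻ (map (λ (i : Fin k) → inject₁ i , suc i) (List.allFin k)) e∈
  ... | inj₁ e∈steps with ∈P.∈-map⁻ _ e∈steps
  ...   | i , _ , refl = later (consecutive-tabulate⁺ f i)
  consecutive-cycle⁺ e∈ | inj₂ (here refl) = now

cycleGraph-simple : ∀ k → 2 ≤ k → Simple (E (cycleGraph (suc k)))
cycleGraph-simple k 2≤k =
  AllPairsP.++⁺ (AllPairsP.map⁺ (AllPairs.map arcs-apart (UniqueP.allFin⁺ k))) ([] ∷ [])
                (All.tabulate λ p∈arcs → last-apart p∈arcs ∷ [])
  where
  arc : Fin k → Fin (suc k) × Fin (suc k)
  arc i = inject₁ i , suc i
  arcs-apart : ∀ {i j} → i ≢ j → ¬ SameEdge (arc i) (arc j)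
  arcs-apart i≢j (inj₁ (e , _)) = i≢j (FinP.inject₁-injective e)
  arcs-apart {i} {j} _ (inj₂ (e₁ , e₂)) = ℕP.1+n≰n (ℕP.≤-trans (ℕP.n≤1+n _) (ℕP.≤-reflexive 2+j≡j))
    where
    2+j≡j : suc (suc (Fin.toℕ j)) ≡ Fin.toℕ j
    2+j≡j = trans (cong suc (trans (sym (cong Fin.toℕ e₁)) (FinP.toℕ-inject₁ i)))
                  (trans (cong Fin.toℕ e₂) (FinP.toℕ-inject₁ j))
  last-apart : ∀ {p} → p ∈ map arc (List.allFin k) → ¬ SameEdge p (fromℕ k , zero)
  last-apart p∈arcs same with ∈P.∈-map⁻ arc p∈arcs | same
  ... | i , _ , refl | inj₂ (e₁ , e₂) = ℕP.<-irrefl refl (subst (2 ≤_) k≡1 2≤k)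
    where
    k≡1 : k ≡ 1
    k≡1 = trans (sym (FinP.toℕ-fromℕ k))
                (trans (sym (cong Fin.toℕ e₂)) (cong suc (trans (sym (FinP.toℕ-inject₁ i)) (cong Fin.toℕ e₁))))

CycleSurvives : ∀ {G} → HamCycle G → Fin (length (E G)) → Set
CycleSurvives {G} C e = ∀ {u v} → Consecutive (HamCycle.base C ∷ HamCycle.vertices C) u v → Adj (deleteEdge G e) u v

-- Numbering the vertices by their position on the cycle turns it into cycleGraph; an edge of G
-- that is not a cycle edge, or a second copy of one, could be deleted without losing the cycle.
critical-hamCycle⇒cycle : ∀ {G} (C : HamCycle G) → (∀ e → ¬ CycleSurvives C e) → IsCycle G
critical-hamCycle⇒cycle (hamCycle _ x [] _ _ spanning) _ with spanning x
... | ()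
critical-hamCycle⇒cycle {G} (hamCycle 3≤n x L@(y ∷ L′) walk@(move _ walk′) unique spanning) critical =
  3≤n , subst (λ k → G ≅ cycleGraph k) (sym n≡) (φ , ≈E-intro simple-A simple-B A⊆B B⊆A)
  where
  pos : Vertex G → Fin (length L)
  pos v = Any.index (spanning v)
  at : Fin (length L) → Vertex G
  at = lookup L
  at-pos : ∀ v → at (pos v) ≡ v
  at-pos v = sym (AnyP.lookup-index (spanning v))
  pos-at : ∀ i → pos (at i) ≡ i
  pos-at i = lookup-injective unique _ _ (at-pos (at i))
  pos-injective : ∀ {u v} → pos u ≡ pos v → u ≡ v
  pos-injective {u} {v} e = trans (sym (at-pos u)) (trans (cong at e) (at-pos v))
  φ : Vertex G ↔ Fin (length L)
  φ = mk↔ₛ′ pos at pos-at at-pos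
  n≡ : n G ≡ length L
  n≡ = ↔⇒≡ φ

  around : x ∷ L ≡ at (fromℕ (length L′)) ∷ tabulate at
  around = cong₂ _∷_ (sym (walk-lookup-last walk′)) (sym (ListP.tabulate-lookup L))

  B = E (cycleGraph (length L))
  A = map (mapEdge pos) (E G)

  on-cycle : ∀ {u v} → Consecutive (x ∷ L) u v → (pos u , pos v) ∈ B
  on-cycle {u} {v} c with consecutive-cycle⁻ at (subst (λ M → Consecutive M u v) around c)
  ... | e , e∈B , refl , refl = subst (_∈ B) (sym (cong₂ _,_ (pos-at _) (pos-at _))) e∈B

  of-cycle : ∀ {e} → e ∈ B → Consecutive (x ∷ L) (at (proj₁ e)) (at (proj₂ e))
  of-cycle {e} e∈B = subst (λ M → Consecutive M (at (proj₁ e)) (at (proj₂ e))) (sym around) (consecutive-cycle⁺ at e∈B)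

  no-parallel-edges : ∀ i j → SameEdge (lookup (E G) i) (lookup (E G) j) → i ≡ j
  no-parallel-edges i j i∥j with i ≟ j
  ... | yes i≡j = i≡j
  ... | no i≢j = ⊥-elim (critical i λ c → AdjL-removeAt-parallel (i≢j ∘ sym) i∥j (walk-consecutive walk c))

  simple-A : Simple A
  simple-A = AllPairsP.map⁺ (AllPairs.map (λ apart → apart ∘ SameEdge-map⁻ pos pos-injective)
                                          (lookup-injective⇒simple (E G) no-parallel-edges))

  simple-B : Simple B
  simple-B = cycleGraph-simple (length L′) (ℕ.s≤s⁻¹ (subst (3 ≤_) n≡ 3≤n))

  A⊆B : ∀ {p} → p ∈ A → ∃ λ q → q ∈ B × SameEdge p q
  A⊆B {p} p∈A with Any.any? (SameEdge? p) B | ∈P.∈-map⁻ (mapEdge pos) p∈A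
  ... | yes found | _ = find found
  ... | no none | (a , b) , ab∈E , refl =
    ⊥-elim (critical (Any.index ab∈E) λ c → AdjL-removeAt (walk-consecutive walk c) (off-cycle c))
    where
    off-cycle : ∀ {u v} → Consecutive (x ∷ L) u v → ¬ SameEdge (lookup (E G) (Any.index ab∈E)) (u , v)
    off-cycle c same = none (Any.map
      (λ { refl → SameEdge-map pos (subst (λ q → SameEdge q _) (sym (AnyP.lookup-index ab∈E)) same) }) (on-cycle c))

  B⊆A : ∀ {q} → q ∈ B → ∃ λ p → p ∈ A × SameEdge p q
  B⊆A {q₁ , q₂} q∈B with walk-consecutive walk (of-cycle q∈B)
  ... | inj₁ uv∈E = _ , ∈P.∈-map⁺ (mapEdge pos) uv∈E , inj₁ (pos-at q₁ , pos-at q₂)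
  ... | inj₂ vu∈E = _ , ∈P.∈-map⁺ (mapEdge pos) vu∈E , inj₂ (pos-at q₂ , pos-at q₁)

minimallyTough⇒critical : ∀ {G} → MinimallyTough G 1ℚ → (C : HamCycle G) → ∀ e → ¬ CycleSurvives C e
minimallyTough⇒critical (_ , drop) (hamCycle 3≤n x L walk unique spanning) e survives =
  let t , (_ , maximal) , t<1 = drop e
  in ℚP.<-irrefl refl (ℚP.<-≤-trans t<1 (maximal 1ℚ
       (hamCycle⇒1-tough (hamCycle 3≤n x L (walk-replace walk survives) unique spanning))))

theorem3p1 : (G : Graph) → SeriesParallel G → MinimallyTough G 1ℚ → IsCycle G
theorem3p1 G (_ , _ , sp) minimal = critical-hamCycle⇒cycle C (minimallyTough⇒critical minimal C)
  where
  C : HamCycle G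
  C = toughness1⇒hamCycle sp (proj₁ minimal)
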